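{- Let $\mathcal{R}$ be a predicative recursive TRS. Then $\mathcal{R}_\bot$ is a completely defined TRS compatible with $>_{pop}$ (i.e. $l>_{pop}r$ for all its rules, where the precedence is extended so that $\bot$ is minimal). Further, $\mathrm{dh}(s,\to^i_{\mathcal{R}})\leqslant\mathrm{dh}(s,\to^i_{\mathcal{R}_\bot})$ for all basic terms $s$.
   Context: Signature $\mathcal{F}$ finite, partitioned into defined symbols $\mathcal{D}$ and constructors $\mathcal{C}$; values: variables and $c(v_1,..,v_n)$, $c\in\mathcal{C}$, $v_i$ values; basic terms: $f(v_1,\dots,v_n)$ with $f\in\mathcal{D}$, $v_i$ values. Constructor TRS: finite, left-hand sides basic. $\to^i$: innermost rewriting. $\mathrm{dh}(s,\to)$: maximal length of a $\to$-sequence from $s$. A TRS is completely defined if no defined symbol occurs in any of its normal forms. Let $\bot\notin\mathcal{F}$ be a fresh constructor; $\mathcal{R}_{\mathcal{S}}$ consists of all rules $u\to\bot$ with $u\in\mathcal{T}(\mathcal{F}\cup\{\bot\},\mathcal{V})$ an $\mathcal{R}$-normal form with defined root; $\mathcal{R}_\bot=\mathcal{R}\cup\mathcal{R}_{\mathcal{S}}$. Safe mapping: each $f$ gets safe positions $\mathrm{safe}(f)$, others normal, constructors all safe; write $f(s_1,\dots,s_k;s_{k+1},\dots,s_{k+l})$. Precedence: preorder $\succeq$ ($\succ$ strict, $\sim$ equivalence), admissible if $f\sim g$ implies both defined or both constructors. $\approx_s$: $s=t$, or same-arity $f\sim g$ and a permutation $\pi$ with $s_i\approx_s t_{\pi(i)}$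 respecting safe/normal status. $G_\downarrow=\{g\mid f\succ g,\ f\in G\}$; $\mathcal{T}(G',\mathcal{V})$ terms over $G'$; $\mathrm{Fun}(s)$ symbols of $s$. $>_{sq}$: $s=f(\ldots)>_{sq}t$ iff (1) $s_i\geqslant_{sq}t$ for some $i$, normal if $f\in\mathcal{D}$, or (2) $f\in\mathcal{D}$, $t=g(t_1,\dots,t_p)$, $f\succ g$, $s>_{sq}t_j$ all $j$ (${\geqslant_{sq}}={>_{sq}}\cup{\approx_s}$). $>_{pop}$: $s>_{pop}t$ iff (1) $s_i\geqslant_{pop}t$ some $i$; or (2) $f\in\mathcal{D}$, $t=g(t_1..t_m;t_{m+1}..t_{m+n})$, $f\succ g$, $s>_{sq}t_j$ for $j\leqslant m$, $s>_{pop}t_j$ for $j>m$, at most one safe $t_j\notin\mathcal{T}(\mathrm{Fun}(s)_\downarrow,\mathcal{V})$; or (3) $f\in\mathcal{D}$, $f\sim g$, $\{s_1..s_k\}>^{mul}_{pop}\{t_1..t_m\}$ and $\{s_{k+1}..s_{k+l}\}\geqslant^{mul}_{pop}\{t_{m+1}..t_{m+n}\}$ (${\geqslant_{pop}}={>_{pop}}\cup{\approx_s}$; multiset extensions on multisets of $\approx_s$-classes, strict: replace nonempty $X$ by $Y$ each of whose elements is below some element of $X$; weak: strict or equal). $\mathcal{R}$ is predicative recursive if it is a constructor TRS with $l>_{pop}r$ for all rules, for some safe mapping and admissible precedence. -}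

module Defs where

open import Data.Nat using (ℕ; zero; suc)
open import Data.Bool using (Bool; true; false; if_then_else_)
open import Data.Fin using (Fin; zero; suc)
open import Data.Maybe using (Maybe; just; nothing)
open import Data.Vec using (Vec; []; _∷_; lookup; _[_]≔_)
open import Data.List using (List; []; _∷_; _++_)
open import Data.List.Membership.Propositional using (_∈_)
open import Data.List.Relation.Unary.All using (All)
open import Data.List.Relation.Unary.Any using (Any)
open import Data.List.Relation.Binary.Permutation.Propositional using (_↭_)
open import Data.List.Relation.Binary.Pointwise using (Pointwise)
open import Data.Product using (Σ; ∃; _×_; _,_)
open import Data.Sum using (_⊎_)
open import Data.Unit using (⊤; tt)
open import Data.Empty using (⊥)
open import Function.Bundles using (_↔_; Inverse)
open import Relation.Nullary using (¬_)
open import Relation.Binary.PropositionalEquality using (_≡_; _≢_)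

record Signature : Set₁ where
  field
    Fun     : Set
    arity   : Fun → ℕ
    defined : Fun → Bool      -- true: f ∈ 𝒟 ; false: f ∈ 𝒞 (constructor)
open Signature public

Finite : Signature → Set
Finite Sg = ∃ λ (enum : List (Fun Sg)) → ∀ f → f ∈ enum

data Term (Sg : Signature) : Set where
  var : ℕ → Term Sg
  fun : (f : Fun Sg) → Vec (Term Sg) (arity Sg f) → Term Sg

module _ {Sg : Signature} where

  data _∈F_ (g : Fun Sg) : Term Sg → Set where
    here  : ∀ {ss} → g ∈F fun g ss
    under : ∀ {f ss} (i : Fin (arity Sg f)) → g ∈F lookup ss i → g ∈F fun f ss

  data _∈V_ (x : ℕ) : Term Sg → Set where
    here  : x ∈V var x
    under : ∀ {f ss} (i : Fin (arity Sg f)) → x ∈V lookup ss i → x ∈V fun f ss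

  data _⊲_ : Term Sg → Term Sg → Set where
    arg    : ∀ {f ss} (i : Fin (arity Sg f)) → lookup ss i ⊲ fun f ss
    deeper : ∀ {u f ss} (i : Fin (arity Sg f)) → u ⊲ lookup ss i → u ⊲ fun f ss

  Subst : Set
  Subst = ℕ → Term Sg

  mutual
    _·_ : Term Sg → Subst → Term Sg
    var x    · σ = σ x
    fun f ss · σ = fun f (substs ss σ)

    substs : ∀ {n} → Vec (Term Sg) n → Subst → Vec (Term Sg) n
    substs []       σ = []
    substs (s ∷ ss) σ = (s · σ) ∷ substs ss σ

  data Value : Term Sg → Set where
    vvar : ∀ x → Value (var x)
    vcon : ∀ {c vs} → defined Sg c ≡ false → (∀ i → Value (lookup vs i)) → Value (fun c vs)

  Basic : Term Sg → Set
  Basic (var x)    = ⊥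
  Basic (fun f ss) = (defined Sg f ≡ true) × (∀ i → Value (lookup ss i))

  DefinedRoot : Term Sg → Set
  DefinedRoot (var x)    = ⊥
  DefinedRoot (fun f ss) = defined Sg f ≡ true

  IsVar : Term Sg → Set
  IsVar (var x)    = ⊤
  IsVar (fun f ss) = ⊥

-- Rewriting w.r.t. a (possibly infinite) set of rules, given as a relation

module Rewriting {Sg : Signature} (R : Term Sg → Term Sg → Set) where

  data _⟶_ : Term Sg → Term Sg → Set where
    root : ∀ {l r} (σ : Subst) → R l r → (l · σ) ⟶ (r · σ)
    ctx  : ∀ {f ss t} (i : Fin (arity Sg f)) → lookup ss i ⟶ t → fun f ss ⟶ fun f (ss [ i ]≔ t)

  NF : Term Sg → Set
  NF s = ∀ t → ¬ (s ⟶ t)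

  data _⟶i_ : Term Sg → Term Sg → Set where
    root : ∀ {l r} (σ : Subst) → R l r → (∀ u → u ⊲ (l · σ) → NF u) → (l · σ) ⟶i (r · σ)
    ctx  : ∀ {f ss t} (i : Fin (arity Sg f)) → lookup ss i ⟶i t → fun f ss ⟶i fun f (ss [ i ]≔ t)

  CompletelyDefined : Set
  CompletelyDefined = ∀ s → NF s → ∀ f → f ∈F s → defined Sg f ≡ false

data Steps {A : Set} (_⇒_ : A → A → Set) : ℕ → A → A → Set where
  done : ∀ {s} → Steps _⇒_ zero s s
  step : ∀ {n s t u} → s ⇒ t → Steps _⇒_ n t u → Steps _⇒_ (suc n) s u

-- dh(s, ⇒) ≤ dh(s', ⇒') (derivation heights in ℕ ∪ {ω}): every ⇒-sequence of
-- length n from s is matched by a ⇒'-sequence of length n from s'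
DhLeq : {A B : Set} → (A → A → Set) → A → (B → B → Set) → B → Set
DhLeq _⇒_ s _⇒'_ s' = ∀ n t → Steps _⇒_ n s t → ∃ λ t' → Steps _⇒'_ n s' t'

WellFormedRules : {Sg : Signature} → (Term Sg → Term Sg → Set) → Set
WellFormedRules {Sg} R = ∀ l r → R l r → ¬ IsVar l × (∀ x → x ∈V r → x ∈V l)

TRS : Signature → Set
TRS Sg = List (Term Sg × Term Sg)

RulesOf : {Sg : Signature} → TRS Sg → Term Sg → Term Sg → Set
RulesOf R l r = (l , r) ∈ R

IsTRS : {Sg : Signature} → TRS Sg → Set
IsTRS R = WellFormedRules (RulesOf R)

ConstructorTRS : {Sg : Signature} → TRS Sg → Set
ConstructorTRS R = IsTRS R × (∀ l r → RulesOf R l r → Basic l)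

record SafeMapping (Sg : Signature) : Set where
  field
    safe     : (f : Fun Sg) → Fin (arity Sg f) → Bool    -- true: safe, false: normal
    con-safe : ∀ f → defined Sg f ≡ false → ∀ i → safe f i ≡ true
open SafeMapping public

record Precedence (Sg : Signature) : Set₁ where
  field
    _≿_    : Fun Sg → Fun Sg → Set
    ≿-refl  : ∀ f → f ≿ f
    ≿-trans : ∀ {f g h} → f ≿ g → g ≿ h → f ≿ h
  _≻_ : Fun Sg → Fun Sg → Set
  f ≻ g = f ≿ g × ¬ (g ≿ f)
  _∼_ : Fun Sg → Fun Sg → Set
  f ∼ g = f ≿ g × g ≿ f

Admissible : {Sg : Signature} → Precedence Sg → Set
Admissible {Sg} P = ∀ f g → Precedence._∼_ P f g → defined Sg f ≡ defined Sg g

select : {Sg : Signature} → ∀ {n} → (Fin n → Bool) → Bool → Vec (Term Sg) n → List (Term Sg)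
select p b [] = []
select {Sg} p true  (x ∷ xs) = if p zero then x ∷ select (λ i → p (suc i)) true xs
                               else select (λ i → p (suc i)) true xs
select {Sg} p false (x ∷ xs) = if p zero then select (λ i → p (suc i)) false xs
                               else x ∷ select (λ i → p (suc i)) false xs

module POP {Sg : Signature} (sm : SafeMapping Sg) (P : Precedence Sg) where
  open Precedence P using (_≻_; _∼_)

  normals safes : (f : Fun Sg) → Vec (Term Sg) (arity Sg f) → List (Term Sg)
  normals f ss = select (safe sm f) false ss
  safes   f ss = select (safe sm f) true  ss

  data _≈s_ : Term Sg → Term Sg → Set where
    ≈-refl : ∀ {s} → s ≈s s
    ≈-perm : ∀ {f g ss ts} → f ∼ g
           → (π : Fin (arity Sg f) ↔ Fin (arity Sg g))
           → (∀ i → safe sm f i ≡ safe sm g (Inverse.to π i))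
           → (∀ i → lookup ss i ≈s lookup ts (Inverse.to π i))
           → fun f ss ≈s fun g ts

  _≈mul_ : List (Term Sg) → List (Term Sg) → Set
  M ≈mul N = ∃ λ L → (M ↭ L) × Pointwise _≈s_ L N

  MulGt : (Term Sg → Term Sg → Set) → List (Term Sg) → List (Term Sg) → Set
  MulGt _>_ M N = ∃ λ X → ∃ λ Y → ∃ λ Z →
    (X ≢ []) × (M ≈mul (Z ++ X)) × (N ≈mul (Z ++ Y)) × All (λ y → Any (λ x → x > y) X) Y

  MulGe : (Term Sg → Term Sg → Set) → List (Term Sg) → List (Term Sg) → Set
  MulGe _>_ M N = MulGt _>_ M N ⊎ (M ≈mul N)

  BelowFun : Term Sg → Term Sg → Set
  BelowFun s t = ∀ g → g ∈F t → ∃ λ f → (f ∈F s) × (f ≻ g)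

  data _>sq_ : Term Sg → Term Sg → Set where
    sq1 : ∀ {f ss t} (i : Fin (arity Sg f))
        → (defined Sg f ≡ true → safe sm f i ≡ false)
        → (lookup ss i >sq t ⊎ lookup ss i ≈s t)
        → fun f ss >sq t
    sq2 : ∀ {f ss g ts} → defined Sg f ≡ true → f ≻ g
        → (∀ j → fun f ss >sq lookup ts j)
        → fun f ss >sq fun g ts

  data _>pop_ : Term Sg → Term Sg → Set where
    pop1 : ∀ {f ss t} (i : Fin (arity Sg f))
         → (lookup ss i >pop t ⊎ lookup ss i ≈s t)
         → fun f ss >pop t
    pop2 : ∀ {f ss g ts} → defined Sg f ≡ true → f ≻ g
         → (∀ j → safe sm g j ≡ false → fun f ss >sq lookup ts j)
         → (∀ j → safe sm g j ≡ true → fun f ss >pop lookup ts j)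
         → (∀ j k → safe sm g j ≡ true → safe sm g k ≡ true
                  → ¬ BelowFun (fun f ss) (lookup ts j)
                  → ¬ BelowFun (fun f ss) (lookup ts k) → j ≡ k)
         → fun f ss >pop fun g ts
    pop3 : ∀ {f ss g ts} → defined Sg f ≡ true → f ∼ g
         → MulGt _>pop_ (normals f ss) (normals g ts)
         → MulGe _>pop_ (safes f ss) (safes g ts)
         → fun f ss >pop fun g ts

PredicativeRecursive : {Sg : Signature} → TRS Sg → SafeMapping Sg → Precedence Sg → Set
PredicativeRecursive R sm P =
  ConstructorTRS R × Admissible P × (∀ l r → RulesOf R l r → POP._>pop_ sm P l r)

-- Extension by a fresh constructor ⊥ (represented by nothing)

ext : Signature → Signature
ext Sg = record
  { Fun = Maybe (Fun Sg)
  ; arity = λ { (just f) → arity Sg f ; nothing → 0 }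
  ; defined = λ { (just f) → defined Sg f ; nothing → false } }

bot : {Sg : Signature} → Term (ext Sg)
bot = fun nothing []

mutual
  emb : {Sg : Signature} → Term Sg → Term (ext Sg)
  emb (var x)    = var x
  emb (fun f ss) = fun (just f) (embs ss)

  embs : {Sg : Signature} → ∀ {n} → Vec (Term Sg) n → Vec (Term (ext Sg)) n
  embs []       = []
  embs (s ∷ ss) = emb s ∷ embs ss

extSafe : {Sg : Signature} → SafeMapping Sg → SafeMapping (ext Sg)
extSafe {Sg} sm = record { safe = sf ; con-safe = cs }
  where
  sf : (f : Fun (ext Sg)) → Fin (arity (ext Sg) f) → Bool
  sf (just f) i = safe sm f i
  sf nothing ()
  cs : ∀ f → defined (ext Sg) f ≡ false → ∀ i → sf f i ≡ true
  cs (just f) d i = con-safe sm f d i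
  cs nothing d ()

extPrec : {Sg : Signature} → Precedence Sg → Precedence (ext Sg)
extPrec {Sg} P = record { _≿_ = ge ; ≿-refl = rf ; ≿-trans = λ {f} {g} {h} → tr {f} {g} {h} }
  where
  ge : Fun (ext Sg) → Fun (ext Sg) → Set
  ge (just f) (just g) = Precedence._≿_ P f g
  ge (just f) nothing  = ⊤
  ge nothing  (just g) = ⊥
  ge nothing  nothing  = ⊤
  rf : ∀ f → ge f f
  rf (just f) = Precedence.≿-refl P f
  rf nothing  = tt
  tr : ∀ {f g h} → ge f g → ge g h → ge f h
  tr {just f} {just g} {just h} p q = Precedence.≿-trans P p q
  tr {just f} {just g} {nothing} p q = tt
  tr {just f} {nothing} {nothing} p q = tt
  tr {nothing} {nothing} {nothing} p q = tt
  tr {just f} {nothing} {just h} p ()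
  tr {nothing} {just g} {h} () q
  tr {nothing} {nothing} {just h} p ()

LiftRules : {Sg : Signature} → TRS Sg → Term (ext Sg) → Term (ext Sg) → Set
LiftRules R l r = ∃ λ l' → ∃ λ r' → RulesOf R l' r' × (l ≡ emb l') × (r ≡ emb r')

RulesS : {Sg : Signature} → TRS Sg → Term (ext Sg) → Term (ext Sg) → Set
RulesS R u r = Rewriting.NF (LiftRules R) u × DefinedRoot u × (r ≡ bot)

RulesBot : {Sg : Signature} → TRS Sg → Term (ext Sg) → Term (ext Sg) → Set
RulesBot R l r = LiftRules R l r ⊎ RulesS R l r

module Submission where

open import Defs
open import Data.Nat using (ℕ; zero; suc; _+_; _≤_; z≤n; s≤s)
open import Data.Nat.Properties using (m≤n+m)
import Data.Nat.Properties as ℕ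
open import Data.Bool using (Bool; true; false)
open import Data.Fin using (Fin; zero; suc)
import Data.Fin.Properties as Fin
open import Data.Maybe using (Maybe; just; nothing; fromMaybe)
import Data.Maybe.Properties as Maybe
open import Data.Vec using (Vec; []; _∷_; lookup; tabulate; _[_]≔_)
open import Data.Vec.Properties using (tabulate∘lookup; tabulate-cong)
open import Data.List using (List; []; _∷_; _++_; map)
import Data.List as List
open import Data.List.Properties using (map-++)
open import Data.List.Membership.Propositional using (find; lose)
open import Data.List.Relation.Unary.All using (All; []; _∷_)
open import Data.List.Relation.Unary.Any using (Any; here; there; index; any?)
open import Data.List.Relation.Unary.Any.Properties using (lookup-index)
open import Data.List.Relation.Binary.Pointwise using (Pointwise; []; _∷_)
import Data.List.Relation.Binary.Permutation.Propositional.Properties as Perm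
open import Data.Product using (∃; ∃₂; _×_; _,_; proj₁; proj₂)
open import Data.Sum using (_⊎_; inj₁; inj₂)
open import Data.Unit using (tt)
open import Data.Empty using (⊥; ⊥-elim)
open import Function using (case_of_; _∘′_)
open import Function.Bundles using (Inverse)
open import Relation.Nullary using (¬_; yes; no)
open import Relation.Nullary.Decidable using (Dec; map′)
open import Relation.Binary.Definitions using (DecidableEquality)
open import Relation.Binary.PropositionalEquality

-- All claims but the last are syntactic: the embedding ℱ ↪ ℱ ∪ {⊥} preserves >pop;
-- an ℛ_𝒮-rule u → ⊥ has a defined root while ⊥ is nullary and minimal, so u >pop ⊥
-- holds by the second clause vacuously; and a defined symbol in an ℛ_⊥-normal form
-- would head an ℛ_𝒮-redex.
--
-- The bound on derivation heights is a step-by-step simulation.  The ℛ_⊥-term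
-- tracking an ℛ-term t agrees with t except that some ℛ-normal subterms v are
-- replaced by a constructor normal form of v.  An ℛ-step at f(v₁,…,vₙ) is mimicked
-- by first normalising the tracked arguments and then applying the same rule, so it
-- costs at least one ℛ_⊥-step.  The normal forms are produced by one fixed strategy,
-- so equal ℛ-subterms get equal normal forms, as non-left-linear rules require.  As
-- ℛ_⊥ need not terminate on these terms, normalisation runs on a step budget: once
-- the budget is exhausted, the derivation sought has been found.

HeightAtLeast : {A : Set} → (A → A → Set) → ℕ → A → Set
HeightAtLeast _⇒_ n a = ∃ (Steps _⇒_ n a)

module _ {A : Set} {_⇒_ : A → A → Set} where

  Steps-++ : ∀ {m n a b c} → Steps _⇒_ m a b → Steps _⇒_ n b c → Steps _⇒_ (m + n) a c
  Steps-++ done       q = q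
  Steps-++ (step s p) q = step s (Steps-++ p q)

  Steps-∷ʳ : ∀ {n a b c} → Steps _⇒_ n a b → b ⇒ c → Steps _⇒_ (suc n) a c
  Steps-∷ʳ done       s′ = step s′ done
  Steps-∷ʳ (step s p) s′ = step s (Steps-∷ʳ p s′)

  HeightAtLeast-≤ : ∀ {m n a} → m ≤ n → HeightAtLeast _⇒_ n a → HeightAtLeast _⇒_ m a
  HeightAtLeast-≤ z≤n       _              = _ , done
  HeightAtLeast-≤ (s≤s m≤n) (_ , step s p) =
    let b , q = HeightAtLeast-≤ m≤n (_ , p) in b , step s q

Steps-map : ∀ {A B : Set} {_⇒_ : A → A → Set} {_⇒′_ : B → B → Set} (f : A → B)
  → (∀ {a b} → a ⇒ b → f a ⇒′ f b)
  → ∀ {n a b} → Steps _⇒_ n a b → Steps _⇒′_ n (f a) (f b)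
Steps-map f f-step done       = done
Steps-map f f-step (step s p) = step (f-step s) (Steps-map f f-step p)

lookup-≗⇒≡ : ∀ {A : Set} {n} (xs ys : Vec A n) → (∀ i → lookup xs i ≡ lookup ys i) → xs ≡ ys
lookup-≗⇒≡ xs ys eq = begin
  xs                 ≡⟨ tabulate∘lookup xs ⟨
  tabulate (lookup xs) ≡⟨ tabulate-cong eq ⟩
  tabulate (lookup ys) ≡⟨ tabulate∘lookup ys ⟩
  ys                 ∎
  where open ≡-Reasoning

map-≡-[] : ∀ {A B : Set} {f : A → B} (xs : List A) → map f xs ≡ [] → xs ≡ []
map-≡-[] []      _  = refl
map-≡-[] (_ ∷ _) ()

finite⇒≟ : (Sg : Signature) → Finite Sg → DecidableEquality (Fun Sg)
finite⇒≟ Sg (enum , complete) f g =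
  map′ index-injective (cong (λ h → index (complete h))) (index (complete f) Fin.≟ index (complete g))
  where
  index-injective : index (complete f) ≡ index (complete g) → f ≡ g
  index-injective eq = trans (lookup-index (complete f))
    (trans (cong (List.lookup enum) eq) (sym (lookup-index (complete g))))

module _ {Sg : Signature} where

  mutual
    ·-identity : (t : Term Sg) → t · var ≡ t
    ·-identity (var x)    = refl
    ·-identity (fun f ss) = cong (fun f) (substs-identity ss)

    substs-identity : ∀ {n} (ss : Vec (Term Sg) n) → substs ss var ≡ ss
    substs-identity []       = refl
    substs-identity (s ∷ ss) = cong₂ _∷_ (·-identity s) (substs-identity ss)

  lookup-substs : ∀ {n} (ss : Vec (Term Sg) n) σ i → lookup (substs ss σ) i ≡ lookup ss i · σ
  lookup-substs (s ∷ ss) σ zero    = refl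
  lookup-substs (s ∷ ss) σ (suc i) = lookup-substs ss σ i

  mutual
    ∈V⇒⊲-· : ∀ {x f} {ss : Vec (Term Sg) (arity Sg f)} (σ : Subst)
      → x ∈V fun f ss → σ x ⊲ (fun f ss · σ)
    ∈V⇒⊲-· {f = f} {ss} σ (under i x∈) with ∈V⇒⊴-· (lookup ss i) σ x∈
    ... | inj₁ eq  = subst (_⊲ fun f (substs ss σ)) (trans (lookup-substs ss σ i) (sym eq)) (arg i)
    ... | inj₂ x⊲ = deeper i (subst (σ _ ⊲_) (sym (lookup-substs ss σ i)) x⊲)

    ∈V⇒⊴-· : ∀ {x} (t : Term Sg) (σ : Subst) → x ∈V t → σ x ≡ t · σ ⊎ σ x ⊲ (t · σ)
    ∈V⇒⊴-· (var x)    σ here = inj₁ refl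
    ∈V⇒⊴-· (fun f ss) σ x∈   = inj₂ (∈V⇒⊲-· σ x∈)

  module _ (_≟F_ : DecidableEquality (Fun Sg)) where
    mutual
      ≟-Term : DecidableEquality (Term Sg)
      ≟-Term (var x)  (var y)  = map′ (cong var) (λ { refl → refl }) (x ℕ.≟ y)
      ≟-Term (var _)  (fun _ _) = no λ ()
      ≟-Term (fun _ _) (var _)  = no λ ()
      ≟-Term (fun f ss) (fun g ts) with f ≟F g
      ... | no f≢g  = no λ { refl → f≢g refl }
      ... | yes refl = map′ (cong (fun f)) (λ { refl → refl }) (≟-Terms ss ts)

      ≟-Terms : ∀ {n} → DecidableEquality (Vec (Term Sg) n)
      ≟-Terms []       []       = yes refl
      ≟-Terms (s ∷ ss) (t ∷ ts) with ≟-Term s t | ≟-Terms ss ts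
      ... | yes refl | yes refl = yes refl
      ... | no s≢t   | _        = no λ { refl → s≢t refl }
      ... | yes _    | no ss≢ts = no λ { refl → ss≢ts refl }

  module _ {R₁ : Term Sg → Term Sg → Set} where
    open Rewriting R₁

    ⟶i⇒⟶ : ∀ {a b} → a ⟶i b → a ⟶ b
    ⟶i⇒⟶ (root σ ρ _) = root σ ρ
    ⟶i⇒⟶ (ctx i s)    = ctx i (⟶i⇒⟶ s)

    NF-arg : ∀ {f ss} → NF (fun f ss) → ∀ i → NF (lookup ss i)
    NF-arg nf i t s = nf _ (ctx i s)

    ⟶-mono : ∀ {R₂ : Term Sg → Term Sg → Set} → (∀ {l r} → R₁ l r → R₂ l r)
      → ∀ {a b} → a ⟶ b → Rewriting._⟶_ R₂ a b
    ⟶-mono R₁⊆R₂ (root σ ρ) = Rewriting.root σ (R₁⊆R₂ ρ)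
    ⟶-mono R₁⊆R₂ (ctx i s)  = Rewriting.ctx i (⟶-mono R₁⊆R₂ s)

module _ {Sg : Signature} where

  lookup-embs : ∀ {n} (ss : Vec (Term Sg) n) i → lookup (embs ss) i ≡ emb (lookup ss i)
  lookup-embs (s ∷ ss) zero    = refl
  lookup-embs (s ∷ ss) (suc i) = lookup-embs ss i

  emb-∈V : ∀ {x} (s : Term Sg) → x ∈V s → x ∈V emb s
  emb-∈V (var x)    here         = here
  emb-∈V (fun f ss) (under i x∈) =
    under i (subst (_ ∈V_) (sym (lookup-embs ss i)) (emb-∈V (lookup ss i) x∈))

  mutual
    emb-∈V⁻ : ∀ {x} (s : Term Sg) → x ∈V emb s → x ∈V s
    emb-∈V⁻ (var x)    here         = here
    emb-∈V⁻ (fun f ss) (under i x∈) = under i (embs-∈V⁻ ss i x∈)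

    embs-∈V⁻ : ∀ {x n} (ss : Vec (Term Sg) n) i → x ∈V lookup (embs ss) i → x ∈V lookup ss i
    embs-∈V⁻ (s ∷ ss) zero    x∈ = emb-∈V⁻ s x∈
    embs-∈V⁻ (s ∷ ss) (suc i) x∈ = embs-∈V⁻ ss i x∈

  emb-∈F : ∀ {g} (s : Term Sg) → g ∈F s → just g ∈F emb s
  emb-∈F (fun f ss) here         = here
  emb-∈F (fun f ss) (under i g∈) =
    under i (subst (_ ∈F_) (sym (lookup-embs ss i)) (emb-∈F (lookup ss i) g∈))

  mutual
    emb-∈F⁻ : ∀ {g} (s : Term Sg) → g ∈F emb s → ∃ λ g′ → g ≡ just g′ × g′ ∈F s
    emb-∈F⁻ (fun f ss) here         = f , refl , here
    emb-∈F⁻ (fun f ss) (under i g∈) =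
      let g′ , eq , g′∈ = embs-∈F⁻ ss i g∈ in g′ , eq , under i g′∈

    embs-∈F⁻ : ∀ {g n} (ss : Vec (Term Sg) n) i → g ∈F lookup (embs ss) i
      → ∃ λ g′ → g ≡ just g′ × g′ ∈F lookup ss i
    embs-∈F⁻ (s ∷ ss) zero    g∈ = emb-∈F⁻ s g∈
    embs-∈F⁻ (s ∷ ss) (suc i) g∈ = embs-∈F⁻ ss i g∈

  select-embs : ∀ {n} (p : Fin n → Bool) b (ss : Vec (Term Sg) n)
    → select p b (embs ss) ≡ map emb (select p b ss)
  select-embs p b     []       = refl
  select-embs p true  (x ∷ xs) with p zero
  ... | true  = cong (emb x ∷_) (select-embs (λ i → p (suc i)) true xs)
  ... | false = select-embs (λ i → p (suc i)) true xs
  select-embs p false (x ∷ xs) with p zero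
  ... | true  = select-embs (λ i → p (suc i)) false xs
  ... | false = cong (emb x ∷_) (select-embs (λ i → p (suc i)) false xs)

module _ {Sg : Signature} (sm : SafeMapping Sg) (P : Precedence Sg) where
  private
    module O = POP sm P
    module E = POP (extSafe sm) (extPrec P)

  emb-≈s : ∀ {s t} → s O.≈s t → emb s E.≈s emb t
  emb-≈s O.≈-refl = E.≈-refl
  emb-≈s {fun f ss} {fun g ts} (O.≈-perm f∼g π safe-π ss≈ts) = E.≈-perm f∼g π safe-π λ i →
    subst₂ E._≈s_ (sym (lookup-embs ss i)) (sym (lookup-embs ts (Inverse.to π i))) (emb-≈s (ss≈ts i))

  emb-≈mul : ∀ {M N} → M O.≈mul N → map emb M E.≈mul map emb N
  emb-≈mul (L , M↭L , L≈N) = map emb L , Perm.map⁺ emb M↭L , pointwise L≈N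
    where
    pointwise : ∀ {L N} → Pointwise O._≈s_ L N → Pointwise E._≈s_ (map emb L) (map emb N)
    pointwise []         = []
    pointwise (x≈y ∷ xs) = emb-≈s x≈y ∷ pointwise xs

  emb-≈mul-++ : ∀ {M} Z X → M O.≈mul (Z ++ X) → map emb M E.≈mul (map emb Z ++ map emb X)
  emb-≈mul-++ {M} Z X eq = subst (map emb M E.≈mul_) (map-++ emb Z X) (emb-≈mul eq)

  emb-BelowFun : ∀ s t → O.BelowFun s t → E.BelowFun (emb s) (emb t)
  emb-BelowFun s t below g g∈ with emb-∈F⁻ t g∈
  ... | g′ , refl , g′∈ = let f , f∈ , f≻g = below g′ g′∈ in just f , emb-∈F s f∈ , f≻g

  emb->sq : ∀ {s t} → s O.>sq t → emb s E.>sq emb t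
  emb->sq {fun f ss} (O.sq1 i normal (inj₁ >t)) =
    E.sq1 i normal (inj₁ (subst (E._>sq _) (sym (lookup-embs ss i)) (emb->sq >t)))
  emb->sq {fun f ss} (O.sq1 i normal (inj₂ ≈t)) =
    E.sq1 i normal (inj₂ (subst (E._≈s _) (sym (lookup-embs ss i)) (emb-≈s ≈t)))
  emb->sq {fun f ss} {fun g ts} (O.sq2 d f≻g >ts) = E.sq2 d f≻g λ j →
    subst (E._>sq_ (emb (fun f ss))) (sym (lookup-embs ts j)) (emb->sq (>ts j))

  mutual
    emb->pop : ∀ {s t} → s O.>pop t → emb s E.>pop emb t
    emb->pop {fun f ss} (O.pop1 i (inj₁ >t)) =
      E.pop1 i (inj₁ (subst (E._>pop _) (sym (lookup-embs ss i)) (emb->pop >t)))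
    emb->pop {fun f ss} (O.pop1 i (inj₂ ≈t)) =
      E.pop1 i (inj₂ (subst (E._≈s _) (sym (lookup-embs ss i)) (emb-≈s ≈t)))
    emb->pop {fun f ss} {fun g ts} (O.pop2 d f≻g normal safe unique) = E.pop2 d f≻g
      (λ j e → arg-emb E._>sq_ j (emb->sq (normal j e)))
      (λ j e → arg-emb E._>pop_ j (emb->pop (safe j e)))
      (λ j k ej ek ¬j ¬k → unique j k ej ek (λ b → ¬j (arg-emb E.BelowFun j (emb-BelowFun _ _ b)))
                                            (λ b → ¬k (arg-emb E.BelowFun k (emb-BelowFun _ _ b))))
      where
      arg-emb : ∀ (Q : Term (ext Sg) → Term (ext Sg) → Set) j
        → Q (emb (fun f ss)) (emb (lookup ts j)) → Q (emb (fun f ss)) (lookup (embs ts) j)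
      arg-emb Q j = subst (Q _) (sym (lookup-embs ts j))
    emb->pop {fun f ss} {fun g ts} (O.pop3 d f∼g normals> safes≥) = E.pop3 d f∼g
      (subst₂ (E.MulGt E._>pop_)
        (sym (select-embs (safe sm f) false ss)) (sym (select-embs (safe sm g) false ts))
        (emb-MulGt normals>))
      (subst₂ (E.MulGe E._>pop_)
        (sym (select-embs (safe sm f) true ss)) (sym (select-embs (safe sm g) true ts))
        (emb-MulGe safes≥))

    emb-MulGt : ∀ {M N} → O.MulGt O._>pop_ M N → E.MulGt E._>pop_ (map emb M) (map emb N)
    emb-MulGt (X , Y , Z , X≢[] , M≈ , N≈ , dominated) =
      map emb X , map emb Y , map emb Z , X≢[] ∘′ map-≡-[] X ,
      emb-≈mul-++ Z X M≈ , emb-≈mul-++ Z Y N≈ , emb-All dominated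

    emb-MulGe : ∀ {M N} → O.MulGe O._>pop_ M N → E.MulGe E._>pop_ (map emb M) (map emb N)
    emb-MulGe (inj₁ gt) = inj₁ (emb-MulGt gt)
    emb-MulGe (inj₂ eq) = inj₂ (emb-≈mul eq)

    emb-All : ∀ {X Y} → All (λ y → Any (O._>pop y) X) Y
      → All (λ y → Any (E._>pop y) (map emb X)) (map emb Y)
    emb-All []         = []
    emb-All (a ∷ as) = emb-Any a ∷ emb-All as

    emb-Any : ∀ {X y} → Any (O._>pop y) X → Any (E._>pop emb y) (map emb X)
    emb-Any (here x>y) = here (emb->pop x>y)
    emb-Any (there a)  = there (emb-Any a)

module _ {Sg : Signature} (R : TRS Sg) where

  RulesBot-wellFormed : IsTRS R → WellFormedRules (RulesBot R)
  RulesBot-wellFormed wf l r (inj₁ (l′ , r′ , ρ , refl , refl)) =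
    emb-¬IsVar l′ (proj₁ (wf l′ r′ ρ)) ,
    λ x x∈ → emb-∈V l′ (proj₂ (wf l′ r′ ρ) x (emb-∈V⁻ r′ x∈))
    where
    emb-¬IsVar : ∀ l → ¬ IsVar l → ¬ IsVar (emb l)
    emb-¬IsVar (var x)    ¬var = ¬var
    emb-¬IsVar (fun f ss) _    = λ ()
  RulesBot-wellFormed wf (fun g ws) r (inj₂ (_ , _ , refl)) = (λ ()) , λ { x (under () _) }

  RulesBot-completelyDefined : Rewriting.CompletelyDefined (RulesBot R)
  RulesBot-completelyDefined (fun nothing  ss) nf .nothing here = refl
  RulesBot-completelyDefined (fun (just f) ss) nf .(just f) here with defined Sg f in eq
  ... | false = refl
  ... | true  = ⊥-elim (nf bot (subst (λ u → Rewriting._⟶_ (RulesBot R) u bot) (·-identity _)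
                  (Rewriting.root var (inj₂ ((λ t s → nf t (⟶-mono inj₁ s)) , eq , refl)))))
  RulesBot-completelyDefined (fun g ss) nf h (under i h∈) =
    RulesBot-completelyDefined (lookup ss i) (NF-arg nf i) h h∈

  RulesBot->pop : (sm : SafeMapping Sg) (P : Precedence Sg)
    → (∀ l r → RulesOf R l r → POP._>pop_ sm P l r)
    → ∀ l r → RulesBot R l r → POP._>pop_ (extSafe sm) (extPrec P) l r
  RulesBot->pop sm P R>pop l r (inj₁ (l′ , r′ , ρ , refl , refl)) = emb->pop sm P (R>pop l′ r′ ρ)
  RulesBot->pop sm P R>pop (fun (just f) ws) r (inj₂ (_ , defined-f , refl)) =
    POP.pop2 defined-f (tt , λ ()) (λ ()) (λ ()) (λ ())

module Matching {Sg : Signature} where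

  mutual
    binding : Term Sg → Term Sg → ℕ → Maybe (Term Sg)
    binding (var y)    w x with y ℕ.≟ x
    ... | yes _ = just w
    ... | no  _ = nothing
    binding (fun g ps) (var _)    x = nothing
    binding (fun g ps) (fun h ws) x = bindings ps ws x

    bindings : ∀ {n m} → Vec (Term Sg) n → Vec (Term Sg) m → ℕ → Maybe (Term Sg)
    bindings []       _        x = nothing
    bindings (_ ∷ _)  []       x = nothing
    bindings (p ∷ ps) (w ∷ ws) x with binding p w x
    ... | just M  = just M
    ... | nothing = bindings ps ws x

  matcher : Term Sg → Term Sg → Subst
  matcher p w x = fromMaybe (var x) (binding p w x)

  module Instances (Q : ℕ → Term Sg → Set) (Q-functional : ∀ {x M N} → Q x M → Q x N → M ≡ N) where

    data Instance : Term Sg → Term Sg → Set where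
      var : ∀ {x w} → Q x w → Instance (var x) w
      fun : ∀ {g ps ws} → (∀ i → Instance (lookup ps i) (lookup ws i)) → Instance (fun g ps) (fun g ws)

    mutual
      binding-sound : ∀ {p w x M} → Instance p w → binding p w x ≡ just M → Q x M
      binding-sound {var y} {w} {x} (var q) eq with y ℕ.≟ x
      ... | yes refl = subst (Q y) (Maybe.just-injective eq) q
      binding-sound {fun g ps} {fun _ ws} (fun inst) eq = bindings-sound {ps = ps} {ws} inst eq

      bindings-sound : ∀ {n} {ps ws : Vec (Term Sg) n} {x M}
        → (∀ i → Instance (lookup ps i) (lookup ws i)) → bindings ps ws x ≡ just M → Q x M
      bindings-sound {ps = p ∷ ps} {w ∷ ws} {x} inst eq with binding p w x in eq′
      ... | just M′ = binding-sound {p} {w} (inst zero) (trans eq′ eq)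
      ... | nothing = bindings-sound {ps = ps} {ws} (λ i → inst (suc i)) eq

    mutual
      binding-complete : ∀ {p w x} → Instance p w → x ∈V p → ∃ λ M → binding p w x ≡ just M
      binding-complete {var y} {w} (var q) here with y ℕ.≟ y
      ... | yes _   = w , refl
      ... | no  y≢y = ⊥-elim (y≢y refl)
      binding-complete {fun g ps} {fun _ ws} (fun inst) (under i x∈) =
        bindings-complete {ps = ps} {ws} inst i x∈

      bindings-complete : ∀ {n} {ps ws : Vec (Term Sg) n} {x}
        → (∀ i → Instance (lookup ps i) (lookup ws i)) → ∀ i → x ∈V lookup ps i
        → ∃ λ M → bindings ps ws x ≡ just M
      bindings-complete {ps = p ∷ ps} {w ∷ ws} {x} inst zero x∈
        with binding p w x | binding-complete {p} {w} (inst zero) x∈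
      ... | just M  | _      = M , refl
      ... | nothing | _ , ()
      bindings-complete {ps = p ∷ ps} {w ∷ ws} {x} inst (suc i) x∈ with binding p w x
      ... | just M  = M , refl
      ... | nothing = bindings-complete {ps = ps} {ws} (λ k → inst (suc k)) i x∈

    matcher-satisfies : ∀ {p w} → Instance p w → ∀ x → x ∈V p → Q x (matcher p w x)
    matcher-satisfies {p} {w} inst x x∈ with binding-complete {p} {w} inst x∈
    ... | M , eq = subst (λ b → Q x (fromMaybe (var x) b)) (sym eq) (binding-sound {p} {w} inst eq)

    mutual
      Instance-· : ∀ {p w} (τ : Subst) → Instance p w → (∀ x → x ∈V p → Q x (τ x)) → p · τ ≡ w
      Instance-· τ (var q) τ-ok = Q-functional (τ-ok _ here) q
      Instance-· {fun g ps} {fun g ws} τ (fun inst) τ-ok =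
        cong (fun g) (Instances-substs τ ps ws inst (λ i x x∈ → τ-ok x (under i x∈)))

      Instances-substs : ∀ {n} (τ : Subst) (ps ws : Vec (Term Sg) n)
        → (∀ i → Instance (lookup ps i) (lookup ws i))
        → (∀ i x → x ∈V lookup ps i → Q x (τ x)) → substs ps τ ≡ ws
      Instances-substs τ []       []       inst τ-ok = refl
      Instances-substs τ (p ∷ ps) (w ∷ ws) inst τ-ok = cong₂ _∷_
        (Instance-· τ (inst zero) (τ-ok zero))
        (Instances-substs τ ps ws (λ i → inst (suc i)) (λ i → τ-ok (suc i)))

    ·-matcher : ∀ {p w} → Instance p w → p · matcher p w ≡ w
    ·-matcher inst = Instance-· _ inst (matcher-satisfies inst)

  module Along (τ : Subst) = Instances (λ x M → τ x ≡ M) (λ τx≡M τx≡N → trans (sym τx≡M) τx≡N)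

  mutual
    ·-Instance : ∀ (τ : Subst) p → Along.Instance τ p (p · τ)
    ·-Instance τ (var x)    = Along.var refl
    ·-Instance τ (fun g ps) = Along.fun (substs-Instance τ ps)

    substs-Instance : ∀ (τ : Subst) {n} (ps : Vec (Term Sg) n) i
      → Along.Instance τ (lookup ps i) (lookup (substs ps τ) i)
    substs-Instance τ (p ∷ ps) zero    = ·-Instance τ p
    substs-Instance τ (p ∷ ps) (suc i) = substs-Instance τ ps i

  match? : DecidableEquality (Term Sg) → (p a : Term Sg) → Dec (∃ λ τ → p · τ ≡ a)
  match? _≟_ p a = map′ (matcher p a ,_) matches ((p · matcher p a) ≟ a)
    where
    matches : (∃ λ τ → p · τ ≡ a) → p · matcher p a ≡ a
    matches (τ , refl) = Along.·-matcher τ (·-Instance τ p)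

module Simulation {Sg : Signature} (_≟F_ : DecidableEquality (Fun Sg))
                  (R : TRS Sg) (R-ctr : ConstructorTRS R) where
  open Matching

  Term⊥ : Set
  Term⊥ = Term (ext Sg)

  _⟶ᵢ_ : Term Sg → Term Sg → Set
  _⟶ᵢ_ = Rewriting._⟶i_ (RulesOf R)

  _⟶ᵢ⊥_ : Term⊥ → Term⊥ → Set
  _⟶ᵢ⊥_ = Rewriting._⟶i_ (RulesBot R)

  NFℛ : Term Sg → Set
  NFℛ = Rewriting.NF (RulesOf R)

  data ConTerm : Term⊥ → Set where
    cvar : ∀ {x} → ConTerm (var x)
    cfun : ∀ {g ws} → defined (ext Sg) g ≡ false → (∀ i → ConTerm (lookup ws i)) → ConTerm (fun g ws)

  ConTerm-irreducible : ∀ {Rl : Term⊥ → Term⊥ → Set} → (∀ {l r} → Rl l r → DefinedRoot l)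
    → ∀ {a b} → ConTerm a → ¬ Rewriting._⟶_ Rl a b
  ConTerm-irreducible lhs-defined con (Rewriting.root {l} σ ρ) = instance-defined l (lhs-defined ρ) con
    where
    instance-defined : ∀ l → DefinedRoot l → ¬ ConTerm (l · σ)
    instance-defined (fun g ls) defined-g (cfun constructor-g _) =
      case trans (sym defined-g) constructor-g of λ ()
  ConTerm-irreducible lhs-defined (cfun _ args) (Rewriting.ctx i s) =
    ConTerm-irreducible lhs-defined (args i) s

  LiftRules-definedRoot : ∀ {l r} → LiftRules R l r → DefinedRoot l
  LiftRules-definedRoot (l′ , r′ , ρ , refl , refl) with l′ | proj₂ R-ctr l′ r′ ρ
  ... | fun f ss | defined-f , _ = defined-f

  RulesBot-definedRoot : ∀ {l r} → RulesBot R l r → DefinedRoot l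
  RulesBot-definedRoot (inj₁ ρ)             = LiftRules-definedRoot ρ
  RulesBot-definedRoot (inj₂ (_ , root , _)) = root

  ConTerm-NF : ∀ {a} → ConTerm a → Rewriting.NF (RulesBot R) a
  ConTerm-NF con _ = ConTerm-irreducible RulesBot-definedRoot con

  ⊲-ConTerm : ∀ {a u} → ConTerm a → u ⊲ a → ConTerm u
  ⊲-ConTerm (cfun _ args) (arg i)      = args i
  ⊲-ConTerm (cfun _ args) (deeper i u⊲) = ⊲-ConTerm (args i) u⊲

  ⊲-args-ConTerm : ∀ {g ws u} → (∀ i → ConTerm (lookup ws i)) → u ⊲ fun g ws → ConTerm u
  ⊲-args-ConTerm args (arg i)       = args i
  ⊲-args-ConTerm args (deeper i u⊲) = ⊲-ConTerm (args i) u⊲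

  root-step : ∀ {g ws l r} (τ : Subst) → RulesBot R l r → l · τ ≡ fun g ws
    → (∀ i → ConTerm (lookup ws i)) → fun g ws ⟶ᵢ⊥ (r · τ)
  root-step {r = r} τ ρ eq args = subst (_⟶ᵢ⊥ (r · τ)) eq
    (Rewriting.root τ ρ λ u u⊲ → ConTerm-NF (⊲-args-ConTerm args (subst (u ⊲_) eq u⊲)))

  _≟⊥_ : DecidableEquality Term⊥
  _≟⊥_ = ≟-Term (Maybe.≡-dec _≟F_)

  MatchingRule : Term⊥ → Term Sg × Term Sg → Set
  MatchingRule a (l , r) = ∃ λ τ → emb l · τ ≡ a

  unmatched-NF : ∀ {f ws} → (∀ i → ConTerm (lookup ws i)) → ¬ Any (MatchingRule (fun (just f) ws)) R
    → Rewriting.NF (LiftRules R) (fun (just f) ws)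
  unmatched-NF {f} {ws} args unmatched _ s = irreducible s refl
    where
    irreducible : ∀ {a b} → Rewriting._⟶_ (LiftRules R) a b → a ≢ fun (just f) ws
    irreducible (Rewriting.root σ (l , r , ρ , refl , refl)) eq = unmatched (lose ρ (σ , eq))
    irreducible (Rewriting.ctx i s) refl = ConTerm-irreducible LiftRules-definedRoot (args i) s

  root-strategy : (g : Fun (ext Sg)) (ws : Vec Term⊥ (arity (ext Sg) g))
    → (∀ i → ConTerm (lookup ws i))
    → ConTerm (fun g ws) ⊎ ∃ (fun g ws ⟶ᵢ⊥_)
  root-strategy nothing  ws args = inj₁ (cfun refl args)
  root-strategy (just f) ws args with defined Sg f in defined-f
  ... | false = inj₁ (cfun defined-f args)
  ... | true with any? (λ (l , r) → match? _≟⊥_ (emb l) (fun (just f) ws)) R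
  ...   | yes matched = let (l , r) , ρ , τ , eq = find matched
                        in inj₂ (_ , root-step τ (inj₁ (l , r , ρ , refl , refl)) eq args)
  ...   | no unmatched =
          inj₂ (bot , root-step var (inj₂ (unmatched-NF args unmatched , defined-f , refl))
                                    (·-identity _) args)

  mutual
    strategy : (a : Term⊥) → ConTerm a ⊎ ∃ (a ⟶ᵢ⊥_)
    strategy (var x) = inj₁ cvar
    strategy (fun g ws) with strategy-args ws
    ... | inj₁ args        = root-strategy g ws args
    ... | inj₂ (i , _ , s) = inj₂ (_ , Rewriting.ctx i s)

    strategy-args : ∀ {n} (ws : Vec Term⊥ n)
      → (∀ i → ConTerm (lookup ws i)) ⊎ ∃ λ i → ∃ (lookup ws i ⟶ᵢ⊥_)
    strategy-args []       = inj₁ λ ()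
    strategy-args (w ∷ ws) with strategy w
    ... | inj₂ (_ , s) = inj₂ (zero , _ , s)
    ... | inj₁ con with strategy-args ws
    ...   | inj₂ (i , _ , s) = inj₂ (suc i , _ , s)
    ...   | inj₁ args        = inj₁ λ { zero → con ; (suc i) → args i }

  data _⇓_ : Term⊥ → Term⊥ → Set where
    stop : ∀ {a} → ConTerm a → a ⇓ a
    go   : ∀ {a b c} {s : a ⟶ᵢ⊥ b} → strategy a ≡ inj₂ (b , s) → b ⇓ c → a ⇓ c

  ⇓-ConTerm : ∀ {a c} → a ⇓ c → ConTerm c
  ⇓-ConTerm (stop con) = con
  ⇓-ConTerm (go _ a⇓c) = ⇓-ConTerm a⇓c

  ConTerm-⇓ : ∀ {a c} → ConTerm a → a ⇓ c → a ≡ c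
  ConTerm-⇓ con (stop _)         = refl
  ConTerm-⇓ con (go {s = s} _ _) = ⊥-elim (ConTerm-irreducible RulesBot-definedRoot con (⟶i⇒⟶ s))

  ⇓-functional : ∀ {a c c′} → a ⇓ c → a ⇓ c′ → c ≡ c′
  ⇓-functional (stop con) a⇓c′ = ConTerm-⇓ con a⇓c′
  ⇓-functional a⇓c        (stop con) = sym (ConTerm-⇓ con a⇓c)
  ⇓-functional (go eq b⇓c) (go eq′ b⇓c′) with trans (sym eq) eq′
  ... | refl = ⇓-functional b⇓c b⇓c′

  run : ∀ F a → HeightAtLeast _⟶ᵢ⊥_ F a ⊎ ∃₂ λ j c → Steps _⟶ᵢ⊥_ j a c × a ⇓ c
  run zero    a = inj₁ (a , done)
  run (suc F) a with strategy a in eq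
  ... | inj₁ con    = inj₂ (0 , a , done , stop con)
  ... | inj₂ (b , s) with run F b
  ...   | inj₁ (_ , long)      = inj₁ (_ , step s long)
  ...   | inj₂ (j , c , p , r) = inj₂ (suc j , c , step s p , go eq r)

  data Canon : Term Sg → Term⊥ → Set where
    var : ∀ {x} → Canon (var x) (var x)
    fun : ∀ {f ss} {Ns : Vec Term⊥ (arity Sg f)} {N}
        → (∀ i → Canon (lookup ss i) (lookup Ns i)) → fun (just f) Ns ⇓ N → Canon (fun f ss) N

  Canon-ConTerm : ∀ {v N} → Canon v N → ConTerm N
  Canon-ConTerm var        = cvar
  Canon-ConTerm (fun _ ⇓N) = ⇓-ConTerm ⇓N

  Canon-functional : ∀ {v N N′} → Canon v N → Canon v N′ → N ≡ N′
  Canon-functional var var = refl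
  Canon-functional (fun {Ns = Ns} args ⇓N) (fun {Ns = Ns′} args′ ⇓N′)
    with lookup-≗⇒≡ Ns Ns′ (λ i → Canon-functional (args i) (args′ i))
  ... | refl = ⇓-functional ⇓N ⇓N′

  data Corresponds : Term Sg → Term⊥ → Set where
    var    : ∀ {x} → Corresponds (var x) (var x)
    fun    : ∀ {f ss ws} → (∀ i → Corresponds (lookup ss i) (lookup ws i))
           → Corresponds (fun f ss) (fun (just f) ws)
    normal : ∀ {v w} → NFℛ v → Canon v w → Corresponds v w

  mutual
    Corresponds-emb : ∀ s → Corresponds s (emb s)
    Corresponds-emb (var x)    = var
    Corresponds-emb (fun f ss) = fun (Corresponds-embs ss)

    Corresponds-embs : ∀ {n} (ss : Vec (Term Sg) n) i → Corresponds (lookup ss i) (lookup (embs ss) i)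
    Corresponds-embs (s ∷ ss) zero    = Corresponds-emb s
    Corresponds-embs (s ∷ ss) (suc i) = Corresponds-embs ss i

  Corresponds-update : ∀ {n a b} (ss : Vec (Term Sg) n) (ws : Vec Term⊥ n)
    → (∀ k → Corresponds (lookup ss k) (lookup ws k)) → Corresponds a b
    → ∀ i k → Corresponds (lookup (ss [ i ]≔ a) k) (lookup (ws [ i ]≔ b) k)
  Corresponds-update (s ∷ ss) (w ∷ ws) args a≈b zero    zero    = a≈b
  Corresponds-update (s ∷ ss) (w ∷ ws) args a≈b zero    (suc k) = args (suc k)
  Corresponds-update (s ∷ ss) (w ∷ ws) args a≈b (suc i) zero    = args zero
  Corresponds-update (s ∷ ss) (w ∷ ws) args a≈b (suc i) (suc k) =
    Corresponds-update ss ws (λ k → args (suc k)) a≈b i k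

  mutual
    Corresponds-· : ∀ (σ : Subst) (τ : Subst) q → (∀ x → x ∈V q → NFℛ (σ x) × Canon (σ x) (τ x))
      → Corresponds (q · σ) (emb q · τ)
    Corresponds-· σ τ (var x)    στ = let nf , canon = στ x here in normal nf canon
    Corresponds-· σ τ (fun g qs) στ = fun (Corresponds-substs σ τ qs λ i x x∈ → στ x (under i x∈))

    Corresponds-substs : ∀ (σ : Subst) (τ : Subst) {n} (qs : Vec (Term Sg) n)
      → (∀ i x → x ∈V lookup qs i → NFℛ (σ x) × Canon (σ x) (τ x))
      → ∀ i → Corresponds (lookup (substs qs σ) i) (lookup (substs (embs qs) τ) i)
    Corresponds-substs σ τ (q ∷ qs) στ zero    = Corresponds-· σ τ q (στ zero)
    Corresponds-substs σ τ (q ∷ qs) στ (suc i) = Corresponds-substs σ τ qs (λ i → στ (suc i)) i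

  data ArgStep {n} : Vec Term⊥ n → Vec Term⊥ n → Set where
    at : ∀ {ws} i {t} → lookup ws i ⟶ᵢ⊥ t → ArgStep ws (ws [ i ]≔ t)

  ArgStep-fun : ∀ {g ws ws′} → ArgStep ws ws′ → fun g ws ⟶ᵢ⊥ fun g ws′
  ArgStep-fun (at i s) = Rewriting.ctx i s

  ArgStep-there : ∀ {n w} {ws ws′ : Vec Term⊥ n} → ArgStep ws ws′ → ArgStep (w ∷ ws) (w ∷ ws′)
  ArgStep-there (at i s) = at (suc i) s

  ArgSteps-at : ∀ {n j b} (ws : Vec Term⊥ n) i → Steps _⟶ᵢ⊥_ j (lookup ws i) b
    → Steps ArgStep j ws (ws [ i ]≔ b)
  ArgSteps-at (w ∷ ws) zero    p = Steps-map (_∷ ws) (at zero) p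
  ArgSteps-at (w ∷ ws) (suc i) p = Steps-map (w ∷_) ArgStep-there (ArgSteps-at ws i p)

  fun-Steps : ∀ {g j ws ws′} → Steps ArgStep j ws ws′ → Steps _⟶ᵢ⊥_ j (fun g ws) (fun g ws′)
  fun-Steps {g} = Steps-map (fun g) ArgStep-fun

  mutual
    normalise : ∀ F v {w} → Corresponds v w
      → HeightAtLeast _⟶ᵢ⊥_ F w ⊎ ∃₂ λ j N → Steps _⟶ᵢ⊥_ j w N × Canon v N
    normalise F (var x)    var          = inj₂ (0 , _ , done , var)
    normalise F v          (normal _ c) = inj₂ (0 , _ , done , c)
    normalise F (fun f ss) (fun {ws = ws} args) with normalise-args F ss ws args
    ... | inj₁ (_ , long) = inj₁ (_ , fun-Steps long)
    ... | inj₂ (j , Ns , p , canons) with run F (fun (just f) Ns)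
    ...   | inj₁ (_ , long) = inj₁ (HeightAtLeast-≤ (m≤n+m F j) (_ , Steps-++ (fun-Steps p) long))
    ...   | inj₂ (j′ , N , q , ⇓N) = inj₂ (j + j′ , N , Steps-++ (fun-Steps p) q , fun canons ⇓N)

    normalise-args : ∀ F {n} (ss : Vec (Term Sg) n) (ws : Vec Term⊥ n)
      → (∀ i → Corresponds (lookup ss i) (lookup ws i))
      → HeightAtLeast ArgStep F ws
        ⊎ ∃₂ λ j Ns → Steps ArgStep j ws Ns × (∀ i → Canon (lookup ss i) (lookup Ns i))
    normalise-args F []       []       args = inj₂ (0 , [] , done , λ ())
    normalise-args F (s ∷ ss) (w ∷ ws) args with normalise F s (args zero)
    ... | inj₁ (_ , long) = inj₁ (_ , Steps-map (_∷ ws) (at zero) long)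
    ... | inj₂ (j , N , p , canon) with normalise-args F ss ws (λ i → args (suc i))
    ...   | inj₁ (_ , long) = inj₁ (_ , Steps-map (w ∷_) ArgStep-there long)
    ...   | inj₂ (j′ , Ns , q , canons) = inj₂ (j + j′ , N ∷ Ns ,
            Steps-++ (Steps-map (_∷ ws) (at zero) p) (Steps-map (N ∷_) ArgStep-there q) ,
            λ { zero → canon ; (suc i) → canons i })

  module CanonOf (σ : Subst) = Instances (λ x M → Canon (σ x) M) Canon-functional

  mutual
    value-Instance : ∀ (σ : Subst) v {N} → Value v → Canon (v · σ) N → CanonOf.Instance σ (emb v) N
    value-Instance σ (var x)    _                  canon = CanonOf.var canon
    value-Instance σ (fun c vs) (vcon ctr-c values) (fun {Ns = Ns} canons ⇓N)
      with ConTerm-⇓ (cfun ctr-c (λ i → Canon-ConTerm (canons i))) ⇓N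
    ... | refl = CanonOf.fun (values-Instance σ vs Ns values canons)

    values-Instance : ∀ (σ : Subst) {n} (vs : Vec (Term Sg) n) Ns → (∀ i → Value (lookup vs i))
      → (∀ i → Canon (lookup (substs vs σ) i) (lookup Ns i))
      → ∀ i → CanonOf.Instance σ (lookup (embs vs) i) (lookup Ns i)
    values-Instance σ (v ∷ vs) (N ∷ Ns) values canons zero    =
      value-Instance σ v (values zero) (canons zero)
    values-Instance σ (v ∷ vs) (N ∷ Ns) values canons (suc i) =
      values-Instance σ vs Ns (λ i → values (suc i)) (λ i → canons (suc i)) i

  Simulated : ℕ → Term Sg → Term⊥ → Set
  Simulated F t w =
    HeightAtLeast _⟶ᵢ⊥_ F w ⊎ ∃₂ λ k w′ → Steps _⟶ᵢ⊥_ (suc k) w w′ × Corresponds t w′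

  simulate-root : ∀ F l r σ → RulesOf R l r → (∀ u → u ⊲ (l · σ) → NFℛ u)
    → ∀ {w} → Corresponds (l · σ) w → Simulated F (r · σ) w
  simulate-root F (var x)    r σ ρ _       _             = ⊥-elim (proj₂ R-ctr (var x) r ρ)
  simulate-root F (fun f vs) r σ ρ _       (normal nf _) = ⊥-elim (nf _ (Rewriting.root σ ρ))
  simulate-root F (fun f vs) r σ ρ args-NF (fun {ws = ws} args) with normalise-args F (substs vs σ) ws args
  ... | inj₁ (_ , long) = inj₁ (_ , fun-Steps long)
  ... | inj₂ (j , Ns , p , canons) =
        inj₂ (j , emb r · τ , Steps-∷ʳ (fun-Steps p) rule-step , Corresponds-· σ τ r στ)
    where
    values : ∀ i → Value (lookup vs i)
    values = proj₂ (proj₂ R-ctr (fun f vs) r ρ)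

    instance-l : CanonOf.Instance σ (emb (fun f vs)) (fun (just f) Ns)
    instance-l = CanonOf.fun (values-Instance σ vs Ns values canons)

    τ : Subst
    τ = matcher (emb (fun f vs)) (fun (just f) Ns)

    rule-step : fun (just f) Ns ⟶ᵢ⊥ (emb r · τ)
    rule-step = root-step τ (inj₁ (fun f vs , r , ρ , refl , refl)) (CanonOf.·-matcher σ instance-l)
      (λ i → Canon-ConTerm (canons i))

    στ : ∀ x → x ∈V r → NFℛ (σ x) × Canon (σ x) (τ x)
    στ x x∈r = args-NF _ (∈V⇒⊲-· σ x∈l)
             , CanonOf.matcher-satisfies σ instance-l x (emb-∈V (fun f vs) x∈l)
      where x∈l = proj₂ (proj₁ R-ctr (fun f vs) r ρ) x x∈r

  simulate-step : ∀ F {t t′ w} → t ⟶ᵢ t′ → Corresponds t w → Simulated F t′ w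
  simulate-step F (Rewriting.root {l} {r} σ ρ args-NF) t≈w = simulate-root F l r σ ρ args-NF t≈w
  simulate-step F (Rewriting.ctx i s) (normal nf _) = ⊥-elim (nf _ (⟶i⇒⟶ (Rewriting.ctx i s)))
  simulate-step F (Rewriting.ctx {f} {ss} i s) (fun {ws = ws} args) with simulate-step F s (args i)
  ... | inj₁ (_ , long) = inj₁ (_ , fun-Steps (ArgSteps-at ws i long))
  ... | inj₂ (k , w′ , p , t≈w′) =
        inj₂ (k , _ , fun-Steps (ArgSteps-at ws i p) , fun (Corresponds-update ss ws args t≈w′ i))

  simulate : ∀ m {t u w} → Steps _⟶ᵢ_ m t u → Corresponds t w → HeightAtLeast _⟶ᵢ⊥_ m w
  simulate zero    done       _   = _ , done
  simulate (suc m) (step s p) t≈w with simulate-step (suc m) s t≈w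
  ... | inj₁ long = long
  ... | inj₂ (k , w′ , q , t′≈w′) =
        HeightAtLeast-≤ (s≤s (m≤n+m m k)) (_ , Steps-++ q (proj₂ (simulate m p t′≈w′)))

  dh-≤ : ∀ s → DhLeq _⟶ᵢ_ s _⟶ᵢ⊥_ (emb s)
  dh-≤ s n _ p = simulate n p (Corresponds-emb s)

lemma6p7 : (Sg : Signature) → Finite Sg
    → (R : TRS Sg) (sm : SafeMapping Sg) (P : Precedence Sg)
    → PredicativeRecursive R sm P
    → WellFormedRules (RulesBot R)
      × Rewriting.CompletelyDefined (RulesBot R)
      × (∀ l r → RulesBot R l r → POP._>pop_ (extSafe sm) (extPrec P) l r)
      × (∀ s → Basic s
           → DhLeq (Rewriting._⟶i_ (RulesOf R)) s (Rewriting._⟶i_ (RulesBot R)) (emb s))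
lemma6p7 Sg finite R sm P (R-ctr , _ , R>pop) =
    RulesBot-wellFormed R (proj₁ R-ctr)
  , RulesBot-completelyDefined R
  , RulesBot->pop R sm P R>pop
  , λ s _ → Simulation.dh-≤ (finite⇒≟ Sg finite) R R-ctr s
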